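{- Let $k\geq 1$ and $a\geq 1$ be integers, let $\Delta_{a}=L_{k,a}^{2}-4(-1)^{a}$, and let $$S_{a}=\frac{1}{2}\begin{bmatrix} L_{k,a} & \Delta_{a} \\ 1 & L_{k,a}\end{bmatrix}.$$ Then for every integer $n\geq 1$, $$S_{a}^{n}=\frac{1}{2F_{k,a}}\begin{bmatrix} \epsilon_{a}(n) & \Delta_{a}F_{k,an} \\ F_{k,an} & \epsilon_{a}(n)\end{bmatrix},$$ where $\epsilon_{a}(n)=2F_{k,a(n+1)}-L_{k,a}F_{k,an}$.
   Context: For an integer $k\geq 1$, the $k$-Fibonacci numbers are defined by $F_{k,0}=0$, $F_{k,1}=1$ and $F_{k,n+1}=kF_{k,n}+F_{k,n-1}$ for $n\geq 1$. The $k$-Lucas numbers are $L_{k,n}=F_{k,n+1}+F_{k,n-1}$. -}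

module Defs where

open import Data.Nat as N using (ℕ; zero; suc; _≤_; s≤s; z≤n; NonZero)
import Data.Nat.Properties as NP
open import Data.Integer as ℤ using (ℤ; +_)
import Data.Rational
open Data.Rational using (ℚ; 0ℚ; 1ℚ) renaming (_+_ to _+q_; _*_ to _*q_)

F : ℕ → ℕ → ℕ
F k zero = 0
F k (suc zero) = 1
F k (suc (suc n)) = k N.* F k (suc n) N.+ F k n

-- k-Lucas numbers: L k n = F k (n+1) + F k (n-1); for n = 0 we use F k (-1) = 1
-- (only n ≥ 1 is used in the statement).
L : ℕ → ℕ → ℕ
L k zero = 2
L k (suc n) = F k (suc (suc n)) N.+ F k n

negOnePow : ℕ → ℤ
negOnePow zero = + 1
negOnePow (suc a) = ℤ.- negOnePow a

Δ : ℕ → ℕ → ℤ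
Δ k a = (+ L k a) ℤ.* (+ L k a) ℤ.- (+ 4) ℤ.* negOnePow a

ε : ℕ → ℕ → ℕ → ℤ
ε k a n = (+ 2) ℤ.* (+ F k (a N.* suc n)) ℤ.- (+ L k a) ℤ.* (+ F k (a N.* n))

record Mat2 : Set where
  constructor mat
  field
    m11 m12 m21 m22 : ℚ

_⊗_ : Mat2 → Mat2 → Mat2
mat a b c d ⊗ mat e f g h =
  mat (a *q e +q b *q g) (a *q f +q b *q h) (c *q e +q d *q g) (c *q f +q d *q h)

I₂ : Mat2
I₂ = mat 1ℚ 0ℚ 0ℚ 1ℚ

_^ᴹ_ : Mat2 → ℕ → Mat2
M ^ᴹ zero = I₂
M ^ᴹ suc n = M ⊗ (M ^ᴹ n)

_·ᴹ_ : ℚ → Mat2 → Mat2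
c ·ᴹ mat a b d e = mat (c *q a) (c *q b) (c *q d) (c *q e)

matℤ : ℤ → ℤ → ℤ → ℤ → Mat2
matℤ a b c d = mat (a Data.Rational./ 1) (b Data.Rational./ 1) (c Data.Rational./ 1) (d Data.Rational./ 1)

F-pos : ∀ k n → 1 ≤ k → 1 ≤ F k (suc n)
F-pos k zero _ = s≤s z≤n
F-pos (suc k) (suc n) hk =
  NP.≤-trans (F-pos (suc k) n hk)
    (NP.≤-trans (NP.m≤n*m (F (suc k) (suc n)) (suc k))
      (NP.m≤m+n _ (F (suc k) n)))

twoF-nonZero : ∀ k a → 1 ≤ k → 1 ≤ a → NonZero (2 N.* F k a)
twoF-nonZero k (suc a) hk ha =
  NP.m*n≢0 2 (F k (suc a)) {{_}} {{N.>-nonZero (F-pos k a hk)}}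

S : ℕ → ℕ → Mat2
S k a = Data.Rational.½ ·ᴹ matℤ (+ L k a) (Δ k a) (+ 1) (+ L k a)

-- F (a (n + 2)) = L_a F (a (n + 1)) − (−1)^a F (a n), by the addition formula and Cassini's
-- identity. Any sequence g with g (n + 2) = ℓ g (n + 1) − s g n makes the integer matrices
-- [[2 g (n + 1) − ℓ g n, (ℓ² − 4 s) g n], [g n, 2 g (n + 1) − ℓ g n]] satisfy
-- [[ℓ, ℓ² − 4 s], [1, ℓ]] M n = 2 M (n + 1); for g n = F (a n) we have M 0 = 2 F a · I, so
-- induction on n gives S_a^n = M n / (2 F a).
module Submission where

open import Defs
open import Data.Nat using (ℕ; _≤_; _*_)
open import Data.Integer using (+_)
open import Data.Rational using (_/_)
open import Relation.Binary.PropositionalEquality using (_≡_)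

open import Data.Nat as ℕ using (zero; suc; NonZero)
import Data.Nat.Properties as ℕ
open import Data.Integer as ℤ using (ℤ; 0ℤ)
import Data.Integer.Properties as ℤ
open import Data.Integer.Tactic.RingSolver using (solve; solve-∀)
open import Data.Rational as ℚ using (ℚ; mkℚ; ½; 1ℚ)
import Data.Rational.Properties as ℚ
import Data.Nat.Coprimality as Coprimality
open import Data.List using (_∷_; [])
open import Data.Maybe using (nothing)
open import Level using (0ℓ)
import Tactic.RingSolver as RingSolver
open import Tactic.RingSolver.Core.AlmostCommutativeRing
  using (AlmostCommutativeRing; fromCommutativeRing)
open import Relation.Binary.PropositionalEquality
  using (refl; sym; trans; cong; cong₂; module ≡-Reasoning)

module KFibonacci (k : ℕ) where

  f : ℕ → ℤ
  f m = + F k m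

  κ : ℤ
  κ = + k

  f-recurrence : ∀ m → f (suc (suc m)) ≡ κ ℤ.* f (suc m) ℤ.+ f m
  f-recurrence m = trans (ℤ.pos-+ (k * F k (suc m)) (F k m)) (cong (ℤ._+ f m) (ℤ.pos-* k _))

  f-addition : ∀ b m → f (suc b ℕ.+ m) ≡ f (suc b) ℤ.* f (suc m) ℤ.+ f b ℤ.* f m
  f-addition zero m = unit (f (suc m)) (f m)
    where
    unit : ∀ x y → x ≡ + 1 ℤ.* x ℤ.+ + 0 ℤ.* y
    unit = solve-∀
  f-addition (suc b) m = begin
      f (suc (suc b) ℕ.+ m)
        ≡⟨ cong (λ t → f (suc t)) (sym (ℕ.+-suc b m)) ⟩
      f (suc b ℕ.+ suc m)
        ≡⟨ f-addition b (suc m) ⟩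
      v ℤ.* f (suc (suc m)) ℤ.+ w ℤ.* f (suc m)
        ≡⟨ cong (λ t → v ℤ.* t ℤ.+ w ℤ.* f (suc m)) (f-recurrence m) ⟩
      v ℤ.* (κ ℤ.* f (suc m) ℤ.+ f m) ℤ.+ w ℤ.* f (suc m)
        ≡⟨ regroup v w κ (f (suc m)) (f m) ⟩
      (κ ℤ.* v ℤ.+ w) ℤ.* f (suc m) ℤ.+ v ℤ.* f m
        ≡⟨ cong (λ t → t ℤ.* f (suc m) ℤ.+ v ℤ.* f m) (sym (f-recurrence b)) ⟩
      f (suc (suc b)) ℤ.* f (suc m) ℤ.+ f (suc b) ℤ.* f m ∎
    where
    open ≡-Reasoning
    v = f (suc b)
    w = f b
    regroup : ∀ v w κ p q → v ℤ.* (κ ℤ.* p ℤ.+ q) ℤ.+ w ℤ.* p ≡ (κ ℤ.* v ℤ.+ w) ℤ.* p ℤ.+ v ℤ.* q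
    regroup = solve-∀

  f-cassini : ∀ b →
    f (suc b) ℤ.* f (suc b) ℤ.- κ ℤ.* f (suc b) ℤ.* f b ℤ.- f b ℤ.* f b ≡ negOnePow b
  f-cassini zero = initial κ
    where
    initial : ∀ κ → + 1 ℤ.* + 1 ℤ.- κ ℤ.* + 1 ℤ.* + 0 ℤ.- + 0 ℤ.* + 0 ≡ + 1
    initial = solve-∀
  f-cassini (suc b) = begin
      u ℤ.* u ℤ.- κ ℤ.* u ℤ.* v ℤ.- v ℤ.* v
        ≡⟨ cong (λ t → t ℤ.* t ℤ.- κ ℤ.* t ℤ.* v ℤ.- v ℤ.* v) (f-recurrence b) ⟩
      (κ ℤ.* v ℤ.+ w) ℤ.* (κ ℤ.* v ℤ.+ w) ℤ.- κ ℤ.* (κ ℤ.* v ℤ.+ w) ℤ.* v ℤ.- v ℤ.* v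
        ≡⟨ flip κ v w ⟩
      ℤ.- (v ℤ.* v ℤ.- κ ℤ.* v ℤ.* w ℤ.- w ℤ.* w)
        ≡⟨ cong ℤ.-_ (f-cassini b) ⟩
      negOnePow (suc b) ∎
    where
    open ≡-Reasoning
    u = f (suc (suc b))
    v = f (suc b)
    w = f b
    flip : ∀ κ v w →
      (κ ℤ.* v ℤ.+ w) ℤ.* (κ ℤ.* v ℤ.+ w) ℤ.- κ ℤ.* (κ ℤ.* v ℤ.+ w) ℤ.* v ℤ.- v ℤ.* v
        ≡ ℤ.- (v ℤ.* v ℤ.- κ ℤ.* v ℤ.* w ℤ.- w ℤ.* w)
    flip = solve-∀

  -- Expanding every term through F(a + j) = F(a+1) F(j+1) + F(a) F(j) leaves a polynomial
  -- identity in F(a+1), F(a), F(m+1), F(m) once (-1)^a is replaced by the Cassini expression.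
  f-lucas-recurrence : ∀ b m →
    f (suc b ℕ.+ (suc b ℕ.+ m)) ℤ.+ negOnePow (suc b) ℤ.* f m ≡ + L k (suc b) ℤ.* f (suc b ℕ.+ m)
  f-lucas-recurrence b m = begin
      f (suc b ℕ.+ (suc b ℕ.+ m)) ℤ.+ negOnePow (suc b) ℤ.* f m
        ≡⟨ cong (ℤ._+ negOnePow (suc b) ℤ.* f m) (f-addition b (suc b ℕ.+ m)) ⟩
      v ℤ.* f (suc (suc b ℕ.+ m)) ℤ.+ w ℤ.* f (suc b ℕ.+ m) ℤ.+ ℤ.- negOnePow b ℤ.* f m
        ≡⟨ cong (λ t → v ℤ.* f t ℤ.+ w ℤ.* f (suc b ℕ.+ m) ℤ.+ ℤ.- negOnePow b ℤ.* f m)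
                (cong suc (sym (ℕ.+-suc b m))) ⟩
      v ℤ.* f (suc b ℕ.+ suc m) ℤ.+ w ℤ.* f (suc b ℕ.+ m) ℤ.+ ℤ.- negOnePow b ℤ.* f m
        ≡⟨ cong₂ (λ t u → v ℤ.* t ℤ.+ w ℤ.* u ℤ.+ ℤ.- negOnePow b ℤ.* f m)
                 (f-addition b (suc m)) (f-addition b m) ⟩
      v ℤ.* (v ℤ.* f (suc (suc m)) ℤ.+ w ℤ.* p) ℤ.+ w ℤ.* (v ℤ.* p ℤ.+ w ℤ.* q)
        ℤ.+ ℤ.- negOnePow b ℤ.* q
        ≡⟨ cong₂ (λ t c → v ℤ.* (v ℤ.* t ℤ.+ w ℤ.* p) ℤ.+ w ℤ.* (v ℤ.* p ℤ.+ w ℤ.* q) ℤ.+ ℤ.- c ℤ.* q)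
                 (f-recurrence m) (sym (f-cassini b)) ⟩
      v ℤ.* (v ℤ.* (κ ℤ.* p ℤ.+ q) ℤ.+ w ℤ.* p) ℤ.+ w ℤ.* (v ℤ.* p ℤ.+ w ℤ.* q)
        ℤ.+ ℤ.- (v ℤ.* v ℤ.- κ ℤ.* v ℤ.* w ℤ.- w ℤ.* w) ℤ.* q
        ≡⟨ factor v w κ p q ⟩
      ((κ ℤ.* v ℤ.+ w) ℤ.+ w) ℤ.* (v ℤ.* p ℤ.+ w ℤ.* q)
        ≡⟨ cong₂ (λ t u → (t ℤ.+ w) ℤ.* u) (sym (f-recurrence b)) (sym (f-addition b m)) ⟩
      (f (suc (suc b)) ℤ.+ w) ℤ.* f (suc b ℕ.+ m)
        ≡⟨ cong (ℤ._* f (suc b ℕ.+ m)) (sym (ℤ.pos-+ (F k (suc (suc b))) (F k b))) ⟩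
      + L k (suc b) ℤ.* f (suc b ℕ.+ m) ∎
    where
    open ≡-Reasoning
    v = f (suc b)
    w = f b
    p = f (suc m)
    q = f m
    factor : ∀ v w κ p q →
      v ℤ.* (v ℤ.* (κ ℤ.* p ℤ.+ q) ℤ.+ w ℤ.* p) ℤ.+ w ℤ.* (v ℤ.* p ℤ.+ w ℤ.* q)
        ℤ.+ ℤ.- (v ℤ.* v ℤ.- κ ℤ.* v ℤ.* w ℤ.- w ℤ.* w) ℤ.* q
        ≡ ((κ ℤ.* v ℤ.+ w) ℤ.+ w) ℤ.* (v ℤ.* p ℤ.+ w ℤ.* q)
    factor = solve-∀

  f-multiples-recurrence : ∀ a → 1 ≤ a → ∀ n →
    f (a * suc (suc n)) ℤ.+ negOnePow a ℤ.* f (a * n) ≡ + L k a ℤ.* f (a * suc n)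
  f-multiples-recurrence (suc b) _ n = begin
      f (a * suc (suc n)) ℤ.+ negOnePow a ℤ.* f (a * n)
        ≡⟨ cong (λ t → f t ℤ.+ negOnePow a ℤ.* f (a * n))
                (trans (ℕ.*-suc a (suc n)) (cong (a ℕ.+_) (ℕ.*-suc a n))) ⟩
      f (a ℕ.+ (a ℕ.+ a * n)) ℤ.+ negOnePow a ℤ.* f (a * n)
        ≡⟨ f-lucas-recurrence b (a * n) ⟩
      + L k a ℤ.* f (a ℕ.+ a * n)
        ≡⟨ cong (λ t → + L k a ℤ.* f t) (sym (ℕ.*-suc a n)) ⟩
      + L k a ℤ.* f (a * suc n) ∎
    where
    open ≡-Reasoning
    a = suc b

-- A data type rather than a record: without η the ring solver sees the entries themselves,
-- not projections out of them.
data Mat2ℤ : Set where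
  matᶻ : ℤ → ℤ → ℤ → ℤ → Mat2ℤ

infixl 7 _⊗ᶻ_
infixr 7 _·ᶻ_

_⊗ᶻ_ : Mat2ℤ → Mat2ℤ → Mat2ℤ
matᶻ a b c d ⊗ᶻ matᶻ e f g h =
  matᶻ (a ℤ.* e ℤ.+ b ℤ.* g) (a ℤ.* f ℤ.+ b ℤ.* h) (c ℤ.* e ℤ.+ d ℤ.* g) (c ℤ.* f ℤ.+ d ℤ.* h)

_·ᶻ_ : ℤ → Mat2ℤ → Mat2ℤ
z ·ᶻ matᶻ a b c d = matᶻ (z ℤ.* a) (z ℤ.* b) (z ℤ.* c) (z ℤ.* d)

⟦_⟧ : Mat2ℤ → Mat2
⟦ matᶻ a b c d ⟧ = matℤ a b c d

matᶻ-cong : ∀ {a b c d a′ b′ c′ d′} →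
  a ≡ a′ → b ≡ b′ → c ≡ c′ → d ≡ d′ → matᶻ a b c d ≡ matᶻ a′ b′ c′ d′
matᶻ-cong refl refl refl refl = refl

mat-cong : ∀ {a b c d a′ b′ c′ d′} →
  a ≡ a′ → b ≡ b′ → c ≡ c′ → d ≡ d′ → mat a b c d ≡ mat a′ b′ c′ d′
mat-cong refl refl refl refl = refl

module SecondOrderRecurrence (ℓ s : ℤ) where

  generator : Mat2ℤ
  generator = matᶻ ℓ (ℓ ℤ.* ℓ ℤ.- + 4 ℤ.* s) (+ 1) ℓ

  pairMatrix : ℤ → ℤ → Mat2ℤ
  pairMatrix p₀ p₁ =
    matᶻ (+ 2 ℤ.* p₁ ℤ.- ℓ ℤ.* p₀) ((ℓ ℤ.* ℓ ℤ.- + 4 ℤ.* s) ℤ.* p₀) p₀ (+ 2 ℤ.* p₁ ℤ.- ℓ ℤ.* p₀)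

  pairMatrix-zero : ∀ p₁ → pairMatrix 0ℤ p₁ ≡ matᶻ (+ 2 ℤ.* p₁) 0ℤ 0ℤ (+ 2 ℤ.* p₁)
  pairMatrix-zero p₁ = matᶻ-cong (solve (ℓ ∷ p₁ ∷ [])) (solve (ℓ ∷ s ∷ [])) refl (solve (ℓ ∷ p₁ ∷ []))

  generator-⊗-pairMatrix : ∀ p₀ p₁ →
    generator ⊗ᶻ pairMatrix p₀ p₁ ≡ + 2 ·ᶻ pairMatrix p₁ (ℓ ℤ.* p₁ ℤ.- s ℤ.* p₀)
  generator-⊗-pairMatrix p₀ p₁ =
    matᶻ-cong (solve (ℓ ∷ s ∷ p₀ ∷ p₁ ∷ [])) (solve (ℓ ∷ s ∷ p₀ ∷ p₁ ∷ []))
              (solve (ℓ ∷ p₀ ∷ p₁ ∷ [])) (solve (ℓ ∷ s ∷ p₀ ∷ p₁ ∷ []))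

  powerMatrix : (ℕ → ℤ) → ℕ → Mat2ℤ
  powerMatrix g n = pairMatrix (g n) (g (suc n))

  powerMatrix-zero : ∀ g → g 0 ≡ 0ℤ → powerMatrix g 0 ≡ matᶻ (+ 2 ℤ.* g 1) 0ℤ 0ℤ (+ 2 ℤ.* g 1)
  powerMatrix-zero g g₀≡0 = trans (cong (λ p₀ → pairMatrix p₀ (g 1)) g₀≡0) (pairMatrix-zero (g 1))

  generator-⊗-powerMatrix : ∀ g → (∀ n → g (suc (suc n)) ℤ.+ s ℤ.* g n ≡ ℓ ℤ.* g (suc n)) →
    ∀ n → generator ⊗ᶻ powerMatrix g n ≡ + 2 ·ᶻ powerMatrix g (suc n)
  generator-⊗-powerMatrix g recurrence n = trans (generator-⊗-pairMatrix (g n) (g (suc n)))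
    (cong (λ p₂ → + 2 ·ᶻ pairMatrix (g (suc n)) p₂) (sym g-next))
    where
    isolate : ∀ x y → x ≡ (x ℤ.+ y) ℤ.- y
    isolate = solve-∀
    g-next : g (suc (suc n)) ≡ ℓ ℤ.* g (suc n) ℤ.- s ℤ.* g n
    g-next = trans (isolate (g (suc (suc n))) (s ℤ.* g n)) (cong (ℤ._- s ℤ.* g n) (recurrence n))

ℚ-ring : AlmostCommutativeRing 0ℓ 0ℓ
ℚ-ring = fromCommutativeRing ℚ.+-*-commutativeRing (λ _ → nothing)

/1≡mkℚ : ∀ x → x / 1 ≡ mkℚ x 0 (Coprimality.sym (Coprimality.1-coprimeTo ℤ.∣ x ∣))
/1≡mkℚ x = ℚ.↥p/↧p≡p (mkℚ x 0 _)

/1-homo-* : ∀ x y → (x ℤ.* y) / 1 ≡ (x / 1) ℚ.* (y / 1)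
/1-homo-* x y = sym (cong₂ ℚ._*_ (/1≡mkℚ x) (/1≡mkℚ y))

/1-homo-+ : ∀ x y → (x ℤ.+ y) / 1 ≡ (x / 1) ℚ.+ (y / 1)
/1-homo-+ x y = sym (trans (cong₂ ℚ._+_ (/1≡mkℚ x) (/1≡mkℚ y))
  (cong (_/ 1) (cong₂ ℤ._+_ (ℤ.*-identityʳ x) (ℤ.*-identityʳ y))))

⟦⟧-homo-⊗ : ∀ A B → ⟦ A ⊗ᶻ B ⟧ ≡ ⟦ A ⟧ ⊗ ⟦ B ⟧
⟦⟧-homo-⊗ (matᶻ a b c d) (matᶻ e f g h) =
  mat-cong (entry a e b g) (entry a f b h) (entry c e d g) (entry c f d h)
  where
  entry : ∀ x y z w → (x ℤ.* y ℤ.+ z ℤ.* w) / 1 ≡ (x / 1) ℚ.* (y / 1) ℚ.+ (z / 1) ℚ.* (w / 1)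
  entry x y z w = trans (/1-homo-+ (x ℤ.* y) (z ℤ.* w)) (cong₂ ℚ._+_ (/1-homo-* x y) (/1-homo-* z w))

⟦⟧-homo-· : ∀ z A → ⟦ z ·ᶻ A ⟧ ≡ (z / 1) ·ᴹ ⟦ A ⟧
⟦⟧-homo-· z (matᶻ a b c d) = mat-cong (/1-homo-* z a) (/1-homo-* z b) (/1-homo-* z c) (/1-homo-* z d)

·ᴹ-assoc : ∀ p q A → p ·ᴹ (q ·ᴹ A) ≡ (p ℚ.* q) ·ᴹ A
·ᴹ-assoc p q (mat a b c d) =
  mat-cong (sym (ℚ.*-assoc p q a)) (sym (ℚ.*-assoc p q b)) (sym (ℚ.*-assoc p q c)) (sym (ℚ.*-assoc p q d))

·ᴹ-⊗-·ᴹ : ∀ p q A B → (p ·ᴹ A) ⊗ (q ·ᴹ B) ≡ (p ℚ.* q) ·ᴹ (A ⊗ B)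
·ᴹ-⊗-·ᴹ p q (mat a b c d) (mat e f g h) =
  mat-cong (entry p q a e b g) (entry p q a f b h) (entry p q c e d g) (entry p q c f d h)
  where
  entry : ∀ p q x y z w → (p ℚ.* x) ℚ.* (q ℚ.* y) ℚ.+ (p ℚ.* z) ℚ.* (q ℚ.* w)
                     ≡ (p ℚ.* q) ℚ.* (x ℚ.* y ℚ.+ z ℚ.* w)
  entry = RingSolver.solve-∀ ℚ-ring

scalar-inverse : ∀ N .{{_ : NonZero N}} →
  (+ 1 / N) ·ᴹ ⟦ matᶻ (+ N) 0ℤ 0ℤ (+ N) ⟧ ≡ I₂
scalar-inverse N@(suc n) = mat-cong N⁻¹N≡1 (ℚ.*-zeroʳ (+ 1 / N)) (ℚ.*-zeroʳ (+ 1 / N)) N⁻¹N≡1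
  where
  N⁻¹N≡1 : (+ 1 / N) ℚ.* (+ N / 1) ≡ 1ℚ
  N⁻¹N≡1 = trans
    (cong₂ ℚ._*_ (ℚ.normalize-coprime (Coprimality.1-coprimeTo N)) (/1≡mkℚ (+ N)))
    (ℚ.*-inverseˡ (mkℚ (+ N) 0 (Coprimality.sym (Coprimality.1-coprimeTo N))))

^ᴹ-from-step : ∀ (A : Mat2ℤ) (B : ℕ → Mat2ℤ) (c : ℚ) →
  c ·ᴹ ⟦ B 0 ⟧ ≡ I₂ → (∀ n → A ⊗ᶻ B n ≡ + 2 ·ᶻ B (suc n)) →
  ∀ n → (½ ·ᴹ ⟦ A ⟧) ^ᴹ n ≡ c ·ᴹ ⟦ B n ⟧
^ᴹ-from-step A B c base step zero = sym base
^ᴹ-from-step A B c base step (suc n) = begin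
    (½ ·ᴹ ⟦ A ⟧) ⊗ ((½ ·ᴹ ⟦ A ⟧) ^ᴹ n)
      ≡⟨ cong ((½ ·ᴹ ⟦ A ⟧) ⊗_) (^ᴹ-from-step A B c base step n) ⟩
    (½ ·ᴹ ⟦ A ⟧) ⊗ (c ·ᴹ ⟦ B n ⟧)
      ≡⟨ ·ᴹ-⊗-·ᴹ ½ c ⟦ A ⟧ ⟦ B n ⟧ ⟩
    (½ ℚ.* c) ·ᴹ (⟦ A ⟧ ⊗ ⟦ B n ⟧)
      ≡⟨ cong ((½ ℚ.* c) ·ᴹ_) (sym (⟦⟧-homo-⊗ A (B n))) ⟩
    (½ ℚ.* c) ·ᴹ ⟦ A ⊗ᶻ B n ⟧
      ≡⟨ cong (λ M → (½ ℚ.* c) ·ᴹ ⟦ M ⟧) (step n) ⟩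
    (½ ℚ.* c) ·ᴹ ⟦ + 2 ·ᶻ B (suc n) ⟧
      ≡⟨ cong ((½ ℚ.* c) ·ᴹ_) (⟦⟧-homo-· (+ 2) (B (suc n))) ⟩
    (½ ℚ.* c) ·ᴹ ((+ 2 / 1) ·ᴹ ⟦ B (suc n) ⟧)
      ≡⟨ ·ᴹ-assoc (½ ℚ.* c) (+ 2 / 1) ⟦ B (suc n) ⟧ ⟩
    ((½ ℚ.* c) ℚ.* (+ 2 / 1)) ·ᴹ ⟦ B (suc n) ⟧
      ≡⟨ cong (_·ᴹ ⟦ B (suc n) ⟧) halve-double ⟩
    c ·ᴹ ⟦ B (suc n) ⟧ ∎
  where
  open ≡-Reasoning
  halve-double : (½ ℚ.* c) ℚ.* (+ 2 / 1) ≡ c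
  halve-double = trans (swap ½ c (+ 2 / 1)) (ℚ.*-identityˡ c)
    where
    swap : ∀ x y z → (x ℚ.* y) ℚ.* z ≡ (x ℚ.* z) ℚ.* y
    swap = RingSolver.solve-∀ ℚ-ring

mainTheorem3 : (k a : ℕ) (hk : 1 ≤ k) (ha : 1 ≤ a) (n : ℕ) → 1 ≤ n →
    S k a ^ᴹ n ≡
      _/_ (+ 1) (2 * F k a) {{twoF-nonZero k a hk ha}}
        ·ᴹ matℤ (ε k a n) (Δ k a Data.Integer.* (+ F k (a * n))) (+ F k (a * n)) (ε k a n)
-- The formula holds for n = 0 as well.
mainTheorem3 k a hk ha n _ =
  ^ᴹ-from-step generator (powerMatrix g) (+ 1 / (2 * F k a)) base
    (generator-⊗-powerMatrix g (KFibonacci.f-multiples-recurrence k a ha)) n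
  where
  open SecondOrderRecurrence (+ L k a) (negOnePow a)
  g : ℕ → ℤ
  g m = + F k (a * m)
  instance
    2Fₐ≢0 : NonZero (2 * F k a)
    2Fₐ≢0 = twoF-nonZero k a hk ha
  2g₁≡2Fₐ : + 2 ℤ.* g 1 ≡ + (2 * F k a)
  2g₁≡2Fₐ = trans (cong (λ t → + 2 ℤ.* + F k t) (ℕ.*-identityʳ a)) (sym (ℤ.pos-* 2 (F k a)))
  base : (+ 1 / (2 * F k a)) ·ᴹ ⟦ powerMatrix g 0 ⟧ ≡ I₂
  base = trans
    (cong (λ M → (+ 1 / (2 * F k a)) ·ᴹ ⟦ M ⟧)
      (trans (powerMatrix-zero g (cong (λ t → + F k t) (ℕ.*-zeroʳ a)))
             (matᶻ-cong 2g₁≡2Fₐ refl refl 2g₁≡2Fₐ)))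
    (scalar-inverse (2 * F k a))
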